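{- If $D$ is a hook diagram, then $\mathcal{P}(D)$ is bounded, i.e., has a unique minimal element and a unique maximal element.
   Context: A diagram is a finite set of cells in $\mathbb{Z}_{>0}\times\mathbb{Z}_{>0}$; a cell $(r,c)$ lies in row $r$ (rows numbered from the bottom, starting at $1$) and column $c$. Applying a Kohnert move at row $r$ of a diagram $D$: if row $r$ is nonempty, let $(r,c)$ be its rightmost cell; if there is $r'$ with $1\le r'<r$ and $(r',c)\notin D$, take the largest such $r'$ and replace $(r,c)$ by $(r',c)$; otherwise $D$ is unchanged. $KD(D)$ is the set of diagrams obtainable from $D$ by finite (possibly empty) sequences of Kohnert moves; $\mathcal{P}(D)$ is $KD(D)$ with $D_2\preceq D_1$ iff $D_2$ can be obtained from $D_1$ by Kohnert moves. For positive integers $r_1\le r_2$ and a finite nonempty $C=\{c_1,\dots,c_m\}\subset\mathbb{Z}_{>0}$ with $c_m=\max C$, $H(r_1,r_2;C)=\{(r_2,c_i)\mid 1\le i\le m\}\cup\{(j,c_m)\mid r_1\le j\le r_2\}$. A hook diagram is a diagram lying in $KD(H(r_1,r_2;C))$ for some such $r_1,r_2,C$. -}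

module Defs where

open import Data.Nat using (ℕ; _≤_; _<_; _⊔_)
open import Data.Product using (_×_; _,_; Σ; ∃; ∃-syntax)
open import Data.Sum using (_⊎_)
open import Data.List using (List; []; _∷_; map; _++_; foldr; upTo)
open import Data.List.Membership.Propositional using (_∈_; _∉_)
open import Relation.Binary.PropositionalEquality using (_≡_; _≢_)
open import Relation.Binary.Construct.Closure.ReflexiveTransitive using (Star)
open import Relation.Nullary using (¬_)

-- A cell (r , c): row r (numbered from the bottom, starting at 1), column c.
Cell : Set
Cell = ℕ × ℕ

-- A diagram is a finite set of cells, represented by a list of cells;
-- two lists represent the same diagram iff they have the same members.
Diagram : Set
Diagram = List Cell

_≈_ : Diagram → Diagram → Set
D ≈ E = ∀ x → (x ∈ D → x ∈ E) × (x ∈ E → x ∈ D)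

RowEmpty : Diagram → ℕ → Set
RowEmpty D r = ∀ c → (r , c) ∉ D

Rightmost : Diagram → ℕ → ℕ → Set
Rightmost D r c = (r , c) ∈ D × (∀ c' → (r , c') ∈ D → c' ≤ c)

-- KohnertMove D r D' : D' is (up to set equality) the result of
-- applying the Kohnert move at row r to D.
data KohnertMove (D : Diagram) (r : ℕ) (D' : Diagram) : Set where
  empty-row : RowEmpty D r → D' ≈ D → KohnertMove D r D'
  blocked : ∀ c → Rightmost D r c →
            (∀ r' → 1 ≤ r' → r' < r → (r' , c) ∈ D) →
            D' ≈ D → KohnertMove D r D'
  -- rightmost cell (r,c); r' is the largest row with 1 ≤ r' < r and (r',c) ∉ D;
  -- replace (r,c) by (r',c)
  move : ∀ c r' → Rightmost D r c →
         1 ≤ r' → r' < r → (r' , c) ∉ D →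
         (∀ r'' → r' < r'' → r'' < r → (r'' , c) ∈ D) →
         (∀ x → (x ∈ D' → ((x ∈ D × x ≢ (r , c)) ⊎ x ≡ (r' , c)))
              × (((x ∈ D × x ≢ (r , c)) ⊎ x ≡ (r' , c)) → x ∈ D')) →
         KohnertMove D r D'

Step : Diagram → Diagram → Set
Step D D' = ∃[ r ] KohnertMove D r D'

Reach : Diagram → Diagram → Set
Reach = Star Step

InKD : Diagram → Diagram → Set
InKD D E = ∃[ F ] (Reach D F × F ≈ E)

-- Order of P(D): D₂ ⪯ D₁ iff D₂ can be obtained from D₁ by Kohnert moves.
_⪯_ : Diagram → Diagram → Set
D₂ ⪯ D₁ = ∃[ F ] (Reach D₁ F × F ≈ D₂)

IsMaximal : Diagram → Diagram → Set
IsMaximal D M = InKD D M × (∀ E → InKD D E → M ⪯ E → E ≈ M)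

IsMinimal : Diagram → Diagram → Set
IsMinimal D m = InKD D m × (∀ E → InKD D E → E ⪯ m → E ≈ m)

Bounded : Diagram → Set
Bounded D =
  (∃[ m ] (IsMinimal D m × (∀ m' → IsMinimal D m' → m' ≈ m)))
  × (∃[ M ] (IsMaximal D M × (∀ M' → IsMaximal D M' → M' ≈ M)))

maxList : List ℕ → ℕ
maxList = foldr _⊔_ 0

-- rows r₁, r₁+1, ..., r₂
range : ℕ → ℕ → List ℕ
range r₁ r₂ = map (λ k → r₁ Data.Nat.+ k) (upTo (Data.Nat.suc (r₂ Data.Nat.∸ r₁)))

H : ℕ → ℕ → List ℕ → Diagram
H r₁ r₂ C = map (λ c → (r₂ , c)) C ++ map (λ j → (j , maxList C)) (range r₁ r₂)

data NonEmpty {A : Set} : List A → Set where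
  nonempty : ∀ {x xs} → NonEmpty (x ∷ xs)

AllPos : List ℕ → Set
AllPos C = ∀ c → c ∈ C → 1 ≤ c

IsHook : Diagram → Set
IsHook D = ∃[ r₁ ] ∃[ r₂ ] ∃[ C ]
  (1 ≤ r₁ × r₁ ≤ r₂ × NonEmpty C × AllPos C × InKD (H r₁ r₂ C) D)

-- Kohnert moves only lower cells, so the sum of the rows of the cells strictly decreases
-- under every move that changes the diagram. Hence reachability is antisymmetric, making D
-- the unique maximal element of P(D), and every diagram reaches a "stuck" one admitting only
-- trivial moves; the minimal elements are exactly the stuck diagrams.
--
-- For a hook diagram the shape of H(r₁, r₂; C) persists: the leg column m = max C keeps its
-- k = r₂ − r₁ + 1 cells, and every other column of C keeps exactly one (arm) cell, at row ≥ k
-- and weakly above the whole leg (an arm cell can only drop by one row, and only when the whole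
-- leg already lies weakly below that row). If such a diagram is stuck, the leg must fill
-- rows 1, …, k and every arm cell must sit in row k, so there is exactly one stuck diagram
-- and P(D) is bounded.

module Submission where

open import Defs
open import Algebra.Properties.CommutativeSemigroup using (interchange)
open import Data.Bool using (if_then_else_)
open import Data.Fin using (Fin; toℕ; fromℕ<)
import Data.Fin.Properties as Fin
open import Data.List using (List; []; _∷_; _++_; [_]; filter; foldr; map)
open import Data.List.Membership.Propositional using (_∈_; _∉_)
open import Data.List.Membership.Propositional.Properties
  using (∈-++⁺ˡ; ∈-++⁺ʳ; ∈-++⁻; ∈-filter⁺; ∈-filter⁻; ∈-map⁺; ∈-map⁻; ∈-upTo⁺; ∈-upTo⁻)
open import Data.List.Relation.Binary.Disjoint.Propositional using (Disjoint)
open import Data.List.Relation.Binary.Subset.Propositional using (_⊆_)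
open import Data.List.Relation.Unary.Any using (here; there)
open import Data.Nat
  using (ℕ; zero; suc; _+_; _∸_; _≤_; _<_; _⊔_; z≤n; s≤s; z<s; _≟_; _≤?_; pred; >-nonZero)
open import Data.Nat.Induction using (<-wellFounded)
open import Data.Nat.Properties
open import Data.Product using (_×_; _,_; ∃-syntax; proj₁; proj₂; swap)
  renaming (map to map×; map₁ to map×₁; map₂ to map×₂)
open import Data.Product.Properties using (≡-dec)
open import Data.Sum using (_⊎_; inj₁; inj₂; [_,_]′) renaming (map to map⊎; map₁ to map⊎₁)
open import Function using (_∘_; id; case_of_; Injective)
open import Induction.WellFounded using (Acc; acc)
open import Relation.Binary.Construct.Closure.ReflexiveTransitive using (ε; _◅_; _◅◅_)
open import Relation.Binary.Definitions using (DecidableEquality)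
open import Relation.Binary.PropositionalEquality
  using (_≡_; _≢_; refl; sym; trans; cong; cong₂; subst; subst₂; module ≡-Reasoning)
open import Relation.Nullary using (¬_; yes; no; contradiction; ¬?; _→-dec_)
open import Relation.Nullary.Decidable using (does; dec-true; dec-false)
open import Relation.Unary using (Decidable)

≈-refl : ∀ {X} → X ≈ X
≈-refl x = id , id

≈-sym : ∀ {X Y} → X ≈ Y → Y ≈ X
≈-sym X≈Y x = swap (X≈Y x)

≈-trans : ∀ {X Y Z} → X ≈ Y → Y ≈ Z → X ≈ Z
≈-trans X≈Y Y≈Z x = proj₁ (Y≈Z x) ∘ proj₁ (X≈Y x) , proj₂ (X≈Y x) ∘ proj₂ (Y≈Z x)

≈⇒⊆ : ∀ {X Y} → X ≈ Y → X ⊆ Y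
≈⇒⊆ X≈Y {x} = proj₁ (X≈Y x)

≈⇒⊇ : ∀ {X Y} → X ≈ Y → Y ⊆ X
≈⇒⊇ X≈Y {x} = proj₂ (X≈Y x)

_≟ᶜ_ : DecidableEquality Cell
_≟ᶜ_ = ≡-dec _≟_ _≟_

open import Data.List.Membership.DecPropositional _≟ᶜ_ using (_∈?_)

InBox : ℕ → Diagram → Set
InBox B X = ∀ {r c} → (r , c) ∈ X → r < B × c < B

bound : Diagram → ℕ
bound = foldr (λ x b → proj₁ x ⊔ proj₂ x ⊔ b) 0

inBox-bound : ∀ X → InBox (suc (bound X)) X
inBox-bound ((r , c) ∷ X) (here refl) =
  s≤s (m≤n⇒m≤n⊔o (bound X) (m≤m⊔n r c)) , s≤s (m≤n⇒m≤n⊔o (bound X) (m≤n⊔m r c))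
inBox-bound (x ∷ X) (there p) = map× grow grow (inBox-bound X p)
  where
  grow : ∀ {n} → n < suc (bound X) → n < suc (bound (x ∷ X))
  grow n<b = <-≤-trans n<b (s≤s (m≤n⊔m _ (bound X)))

-- The move at a row above every cell is the trivial one, so set-equal diagrams are one Step apart.
≈⇒Step : ∀ {X Y} → X ≈ Y → Step X Y
≈⇒Step {X} X≈Y =
  suc (bound X) , empty-row (λ c p → <-irrefl refl (proj₁ (inBox-bound X p))) (≈-sym X≈Y)

Relocation : Diagram → Cell → Cell → Diagram → Set
Relocation X a b Y =
  ∀ x → (x ∈ Y → (x ∈ X × x ≢ a) ⊎ x ≡ b) × ((x ∈ X × x ≢ a) ⊎ x ≡ b → x ∈ Y)

Rightmost-resp-≈ : ∀ {X Y r c} → X ≈ Y → Rightmost X r c → Rightmost Y r c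
Rightmost-resp-≈ X≈Y (p , max) = ≈⇒⊆ X≈Y p , λ c' → max c' ∘ ≈⇒⊇ X≈Y

Relocation-respˡ-≈ : ∀ {X Y Z a b} → X ≈ Y → Relocation X a b Z → Relocation Y a b Z
Relocation-respˡ-≈ X≈Y rel x =
  map⊎₁ (map×₁ (≈⇒⊆ X≈Y)) ∘ proj₁ (rel x) , proj₂ (rel x) ∘ map⊎₁ (map×₁ (≈⇒⊇ X≈Y))

relocation-∉ : ∀ {X Y a b} → a ∈ X → b ∉ X → Relocation X a b Y → a ∉ Y
relocation-∉ a∈X b∉X rel a∈Y with proj₁ (rel _) a∈Y
... | inj₁ (_ , a≢a) = a≢a refl
... | inj₂ refl = b∉X a∈X

relocation-≈ : ∀ {X Y a b} → a ∈ X → b ∉ X → Relocation X a b Y → (Y ++ [ a ]) ≈ (X ++ [ b ])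
relocation-≈ {X} {Y} {a} {b} a∈X b∉X rel x = to , from
  where
  to : x ∈ Y ++ [ a ] → x ∈ X ++ [ b ]
  to p with ∈-++⁻ Y p
  ... | inj₂ (here refl) = ∈-++⁺ˡ a∈X
  ... | inj₂ (there ())
  ... | inj₁ x∈Y with proj₁ (rel x) x∈Y
  ...   | inj₁ (x∈X , _) = ∈-++⁺ˡ x∈X
  ...   | inj₂ refl = ∈-++⁺ʳ X (here refl)
  from : x ∈ X ++ [ b ] → x ∈ Y ++ [ a ]
  from p with ∈-++⁻ X p
  ... | inj₂ (here refl) = ∈-++⁺ˡ (proj₂ (rel x) (inj₂ refl))
  ... | inj₂ (there ())
  ... | inj₁ x∈X with x ≟ᶜ a
  ...   | yes refl = ∈-++⁺ʳ Y (here refl)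
  ...   | no x≢a = ∈-++⁺ˡ (proj₂ (rel x) (inj₁ (x∈X , x≢a)))

relocation-other-column : ∀ {E E' r r' c c₀ ρ} → Relocation E (r , c) (r' , c) E' → c₀ ≢ c →
  ((ρ , c₀) ∈ E' → (ρ , c₀) ∈ E) × ((ρ , c₀) ∈ E → (ρ , c₀) ∈ E')
relocation-other-column {E} {E'} {r} {r'} {c} {c₀} {ρ} rel c₀≢c = from , to
  where
  from : (ρ , c₀) ∈ E' → (ρ , c₀) ∈ E
  from p with proj₁ (rel _) p
  ... | inj₁ (p' , _) = p'
  ... | inj₂ refl = contradiction refl c₀≢c
  to : (ρ , c₀) ∈ E → (ρ , c₀) ∈ E'
  to p = proj₂ (rel _) (inj₁ (p , c₀≢c ∘ cong proj₂))

relocation-rows-positive : ∀ {E E' a b} → (∀ {ρ c} → (ρ , c) ∈ E → 1 ≤ ρ) → 1 ≤ proj₁ b →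
  Relocation E a b E' → ∀ {ρ c} → (ρ , c) ∈ E' → 1 ≤ ρ
relocation-rows-positive positive 1≤b rel p with proj₁ (rel _) p
... | inj₁ (p' , _) = positive p'
... | inj₂ refl = 1≤b

KohnertMove-respˡ-≈ : ∀ {X Y r Z} → X ≈ Y → KohnertMove X r Z → KohnertMove Y r Z
KohnertMove-respˡ-≈ X≈Y (empty-row empty Z≈X) =
  empty-row (λ c → empty c ∘ ≈⇒⊇ X≈Y) (≈-trans Z≈X X≈Y)
KohnertMove-respˡ-≈ X≈Y (blocked c rm full Z≈X) =
  blocked c (Rightmost-resp-≈ X≈Y rm) (λ r' p q → ≈⇒⊆ X≈Y (full r' p q)) (≈-trans Z≈X X≈Y)
KohnertMove-respˡ-≈ X≈Y (move c r' rm 1≤r' r'<r free between rel) =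
  move c r' (Rightmost-resp-≈ X≈Y rm) 1≤r' r'<r (free ∘ ≈⇒⊇ X≈Y)
       (λ r'' p q → ≈⇒⊆ X≈Y (between r'' p q)) (Relocation-respˡ-≈ X≈Y rel)

Reach-respˡ-≈ : ∀ {X Y Z} → X ≈ Y → Reach Y Z → Reach X Z
Reach-respˡ-≈ X≈Y ε = ≈⇒Step X≈Y ◅ ε
Reach-respˡ-≈ X≈Y ((r , mv) ◅ path) = (r , KohnertMove-respˡ-≈ (≈-sym X≈Y) mv) ◅ path

RowBlocked : Diagram → ℕ → Set
RowBlocked X r = ∀ c → Rightmost X r c → ∀ r' → 1 ≤ r' → r' < r → (r' , c) ∈ X

Stuck : Diagram → Set
Stuck X = ∀ r → RowBlocked X r

Stuck-resp-≈ : ∀ {X Y} → X ≈ Y → Stuck X → Stuck Y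
Stuck-resp-≈ X≈Y stuck r c rm r' p q = ≈⇒⊆ X≈Y (stuck r c (Rightmost-resp-≈ (≈-sym X≈Y) rm) r' p q)

stuck-KohnertMove : ∀ {X r Y} → Stuck X → KohnertMove X r Y → Y ≈ X
stuck-KohnertMove stuck (empty-row _ Y≈X) = Y≈X
stuck-KohnertMove stuck (blocked _ _ _ Y≈X) = Y≈X
stuck-KohnertMove {r = r} stuck (move c r' rm 1≤r' r'<r free _ _) =
  contradiction (stuck r c rm r' 1≤r' r'<r) free

stuck-Reach : ∀ {X Y} → Stuck X → Reach X Y → Y ≈ X
stuck-Reach stuck ε = ≈-refl
stuck-Reach stuck ((_ , mv) ◅ path) =
  let Z≈X = stuck-KohnertMove stuck mv
  in ≈-trans (stuck-Reach (Stuck-resp-≈ (≈-sym Z≈X) stuck) path) Z≈X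

record Movable (X : Diagram) : Set where
  constructor movable
  field
    row col target : ℕ
    rightmost : Rightmost X row col
    1≤target : 1 ≤ target
    target<row : target < row
    target-free : (target , col) ∉ X
    between-full : ∀ r → target < r → r < row → (r , col) ∈ X

module _ {X : Diagram} (mv : Movable X) where
  open Movable mv

  moved : Diagram
  moved = (target , col) ∷ filter (¬? ∘ (_≟ᶜ (row , col))) X

  moved-relocation : Relocation X (row , col) (target , col) moved
  moved-relocation x = to , from
    where
    to : x ∈ moved → (x ∈ X × x ≢ (row , col)) ⊎ x ≡ (target , col)
    to (here x≡t) = inj₂ x≡t
    to (there p) = inj₁ (∈-filter⁻ (¬? ∘ (_≟ᶜ (row , col))) p)
    from : (x ∈ X × x ≢ (row , col)) ⊎ x ≡ (target , col) → x ∈ moved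
    from (inj₁ (p , x≢s)) = there (∈-filter⁺ (¬? ∘ (_≟ᶜ (row , col))) p x≢s)
    from (inj₂ x≡t) = here x≡t

  moved-move : KohnertMove X row moved
  moved-move =
    move col target rightmost 1≤target target<row target-free between-full moved-relocation

  moved-≉ : ¬ moved ≈ X
  moved-≉ moved≈X =
    relocation-∉ (proj₁ rightmost) target-free moved-relocation (≈⇒⊇ moved≈X (proj₁ rightmost))

∈-all⊎ : ∀ {A : Set} {P : A → Set} {Q : Set} (L : List A) →
         (∀ {y} → y ∈ L → P y ⊎ Q) → (∀ {y} → y ∈ L → P y) ⊎ Q
∈-all⊎ [] f = inj₁ λ ()
∈-all⊎ (x ∷ L) f with f (here refl) | ∈-all⊎ L (f ∘ there)
... | inj₂ q | _ = inj₂ q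
... | inj₁ _ | inj₂ q = inj₂ q
... | inj₁ px | inj₁ pL = inj₁ λ { (here refl) → px ; (there p) → pL p }

∀<⊎lastCounterexample : ∀ {P : ℕ → Set} → Decidable P → ∀ n →
  (∀ i → i < n → P i) ⊎ ∃[ i ] (i < n × ¬ P i × ∀ j → i < j → j < n → P j)
∀<⊎lastCounterexample P? zero = inj₁ λ _ ()
∀<⊎lastCounterexample P? (suc n) with P? n | ∀<⊎lastCounterexample P? n
... | no ¬Pn | _ = inj₂ (n , ≤-refl , ¬Pn , λ j n<j j<1+n → contradiction (≤-pred j<1+n) (<⇒≱ n<j))
... | yes Pn | inj₁ below = inj₁ λ j j<1+n →
  [ below j , (λ { refl → Pn }) ]′ (m<1+n⇒m<n∨m≡n j<1+n)
... | yes Pn | inj₂ (i , i<n , ¬Pi , above) = inj₂ (i , m<n⇒m<1+n i<n , ¬Pi , λ j i<j j<1+n →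
  [ above j i<j , (λ { refl → Pn }) ]′ (m<1+n⇒m<n∨m≡n j<1+n))

RowEmpty⊎Rightmost : ∀ X r → RowEmpty X r ⊎ ∃[ c ] Rightmost X r c
RowEmpty⊎Rightmost [] r = inj₁ λ _ ()
RowEmpty⊎Rightmost ((r₀ , c₀) ∷ X) r with r₀ ≟ r | RowEmpty⊎Rightmost X r
... | no r₀≢r | inj₁ empty = inj₁ λ { c (here refl) → r₀≢r refl ; c (there p) → empty c p }
... | no r₀≢r | inj₂ (c , p , max) =
  inj₂ (c , there p , λ { c' (here refl) → contradiction refl r₀≢r ; c' (there q) → max c' q })
... | yes refl | inj₁ empty =
  inj₂ (c₀ , here refl , λ { c' (here refl) → ≤-refl ; c' (there q) → contradiction q (empty c') })
... | yes refl | inj₂ (c , p , max) with ≤-total c₀ c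
...   | inj₁ c₀≤c = inj₂ (c , there p , λ { c' (here refl) → c₀≤c ; c' (there q) → max c' q })
...   | inj₂ c≤c₀ =
  inj₂ (c₀ , here refl , λ { c' (here refl) → ≤-refl ; c' (there q) → ≤-trans (max c' q) c≤c₀ })

Rightmost-unique : ∀ {X r c c'} → Rightmost X r c → Rightmost X r c' → c ≡ c'
Rightmost-unique (p , max) (p' , max') = ≤-antisym (max' _ p) (max _ p')

rowBlocked⊎movable : ∀ X r → RowBlocked X r ⊎ Movable X
rowBlocked⊎movable X r with RowEmpty⊎Rightmost X r
... | inj₁ empty = inj₁ λ c rm → contradiction (proj₁ rm) (empty c)
... | inj₂ (c , rm) with ∀<⊎lastCounterexample (λ i → 1 ≤? i →-dec (i , c) ∈? X) r
...   | inj₁ full = inj₁ λ c' rm' r' 1≤r' r'<r →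
          subst (λ c → (r' , c) ∈ X) (Rightmost-unique rm rm') (full r' r'<r 1≤r')
...   | inj₂ (i , i<r , unfilled , above) with 1 ≤? i | (i , c) ∈? X
...     | no i≱1 | _ = contradiction (λ 1≤i → contradiction 1≤i i≱1) unfilled
...     | yes _ | yes p = contradiction (λ _ → p) unfilled
...     | yes 1≤i | no free =
          inj₂ (movable r c i rm 1≤i i<r free λ j i<j j<r → above j i<j j<r (≤-trans 1≤i (<⇒≤ i<j)))

stuck⊎movable : ∀ X → Stuck X ⊎ Movable X
stuck⊎movable X with ∈-all⊎ X (λ {y} _ → rowBlocked⊎movable X (proj₁ y))
... | inj₁ rowsBlocked = inj₁ λ r c rm → rowsBlocked (proj₁ rm) c rm
... | inj₂ mv = inj₂ mv

-- A potential lowered by every proper move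

∑< : ℕ → (ℕ → ℕ) → ℕ
∑< zero f = 0
∑< (suc n) f = ∑< n f + f n

∑<-cong : ∀ n {f g : ℕ → ℕ} → (∀ i → f i ≡ g i) → ∑< n f ≡ ∑< n g
∑<-cong zero f≗g = refl
∑<-cong (suc n) f≗g = cong₂ _+_ (∑<-cong n f≗g) (f≗g n)

∑<-distrib-+ : ∀ n (f g : ℕ → ℕ) → ∑< n (λ i → f i + g i) ≡ ∑< n f + ∑< n g
∑<-distrib-+ zero f g = refl
∑<-distrib-+ (suc n) f g =
  trans (cong (_+ (f n + g n)) (∑<-distrib-+ n f g))
        (interchange +-commutativeSemigroup (∑< n f) (∑< n g) (f n) (g n))

∑<-zero : ∀ n {f : ℕ → ℕ} → (∀ i → i < n → f i ≡ 0) → ∑< n f ≡ 0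
∑<-zero zero f≗0 = refl
∑<-zero (suc n) f≗0 = cong₂ _+_ (∑<-zero n λ i → f≗0 i ∘ m<n⇒m<1+n) (f≗0 n ≤-refl)

∑<-single : ∀ {n a} {f : ℕ → ℕ} → a < n → (∀ i → i ≢ a → f i ≡ 0) → ∑< n f ≡ f a
∑<-single {suc n} {a} {f} a<1+n others with n ≟ a
... | yes refl = cong (_+ f n) (∑<-zero n λ i i<n → others i (<⇒≢ i<n))
... | no n≢a =
  trans (cong₂ _+_ (∑<-single (≤∧≢⇒< (≤-pred a<1+n) (n≢a ∘ sym)) others) (others n n≢a))
        (+-identityʳ (f a))

weight : Diagram → Cell → ℕ
weight X x = if does (x ∈? X) then proj₁ x else 0

weight-∈ : ∀ {X x} → x ∈ X → weight X x ≡ proj₁ x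
weight-∈ {X} {x} x∈X = cong (if_then proj₁ x else 0) (dec-true (x ∈? X) x∈X)

weight-∉ : ∀ {X x} → x ∉ X → weight X x ≡ 0
weight-∉ {X} {x} x∉X = cong (if_then proj₁ x else 0) (dec-false (x ∈? X) x∉X)

weight-resp-≈ : ∀ {X Y} → X ≈ Y → ∀ x → weight X x ≡ weight Y x
weight-resp-≈ {X} X≈Y x = case x ∈? X of λ where
  (yes x∈X) → trans (weight-∈ x∈X) (sym (weight-∈ (≈⇒⊆ X≈Y x∈X)))
  (no x∉X) → trans (weight-∉ x∉X) (sym (weight-∉ (x∉X ∘ ≈⇒⊇ X≈Y)))

weight-++ : ∀ {X Y} → Disjoint X Y → ∀ x → weight (X ++ Y) x ≡ weight X x + weight Y x
weight-++ {X} {Y} disjoint x = case ((x ∈? X) , (x ∈? Y)) of λ where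
  (yes x∈X , yes x∈Y) → contradiction (x∈X , x∈Y) disjoint
  (yes x∈X , no x∉Y) →
    trans (weight-∈ {X ++ Y} (∈-++⁺ˡ x∈X))
          (sym (trans (cong₂ _+_ (weight-∈ x∈X) (weight-∉ x∉Y)) (+-identityʳ _)))
  (no x∉X , yes x∈Y) →
    trans (weight-∈ {X ++ Y} (∈-++⁺ʳ X x∈Y)) (sym (cong₂ _+_ (weight-∉ x∉X) (weight-∈ x∈Y)))
  (no x∉X , no x∉Y) →
    trans (weight-∉ {X ++ Y} ([ x∉X , x∉Y ]′ ∘ ∈-++⁻ X))
          (sym (cong₂ _+_ (weight-∉ x∉X) (weight-∉ x∉Y)))

-- The row sum of X is taken over the box B × B rather than over the list, so that it
-- respects ≈ (a list may repeat cells).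
μ : ℕ → Diagram → ℕ
μ B X = ∑< B λ i → ∑< B λ j → weight X (i , j)

μ-resp-≈ : ∀ B {X Y} → X ≈ Y → μ B X ≡ μ B Y
μ-resp-≈ B X≈Y = ∑<-cong B λ i → ∑<-cong B λ j → weight-resp-≈ X≈Y (i , j)

μ-++ : ∀ B {X Y} → Disjoint X Y → μ B (X ++ Y) ≡ μ B X + μ B Y
μ-++ B disjoint =
  trans (∑<-cong B λ i → trans (∑<-cong B λ j → weight-++ disjoint (i , j)) (∑<-distrib-+ B _ _))
        (∑<-distrib-+ B _ _)

μ-singleton : ∀ {B r c} → r < B → c < B → μ B [ (r , c) ] ≡ r
μ-singleton {B} {r} {c} r<B c<B =
  trans (∑<-single r<B otherRows)
        (trans (∑<-single c<B otherColumns) (weight-∈ {[ (r , c) ]} (here refl)))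
  where
  otherRows : ∀ i → i ≢ r → ∑< B (λ j → weight [ (r , c) ] (i , j)) ≡ 0
  otherRows i i≢r =
    ∑<-zero B λ j _ → weight-∉ {[ (r , c) ]} {i , j} λ { (here refl) → i≢r refl ; (there ()) }
  otherColumns : ∀ j → j ≢ c → weight [ (r , c) ] (r , j) ≡ 0
  otherColumns j j≢c = weight-∉ {[ (r , c) ]} {r , j} λ { (here refl) → j≢c refl ; (there ()) }

relocation-μ : ∀ B {X Y a b} → a ∈ X → b ∉ X → Relocation X a b Y →
               μ B Y + μ B [ a ] ≡ μ B X + μ B [ b ]
relocation-μ B {X} {Y} {a} {b} a∈X b∉X rel = begin
  μ B Y + μ B [ a ]  ≡⟨ μ-++ B {Y} (λ { (p , here refl) → relocation-∉ a∈X b∉X rel p }) ⟨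
  μ B (Y ++ [ a ])   ≡⟨ μ-resp-≈ B (relocation-≈ a∈X b∉X rel) ⟩
  μ B (X ++ [ b ])   ≡⟨ μ-++ B {X} (λ { (p , here refl) → b∉X p }) ⟩
  μ B X + μ B [ b ]  ∎
  where open ≡-Reasoning

KohnertMove-InBox : ∀ {B X r Y} → InBox B X → KohnertMove X r Y → InBox B Y
KohnertMove-InBox box (empty-row _ Y≈X) p = box (≈⇒⊆ Y≈X p)
KohnertMove-InBox box (blocked _ _ _ Y≈X) p = box (≈⇒⊆ Y≈X p)
KohnertMove-InBox box (move c r' (source , _) _ r'<r _ _ rel) p with proj₁ (rel _) p
... | inj₁ (p' , _) = box p'
... | inj₂ refl = map×₁ (<-trans r'<r) (box source)

KohnertMove-μ : ∀ {B X r Y} → InBox B X → KohnertMove X r Y → μ B Y < μ B X ⊎ Y ≈ X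
KohnertMove-μ box (empty-row _ Y≈X) = inj₂ Y≈X
KohnertMove-μ box (blocked _ _ _ Y≈X) = inj₂ Y≈X
KohnertMove-μ {B} {X} {r} {Y} box (move c r' (source , _) _ r'<r free _ rel) =
  inj₁ (+-cancelʳ-< r (μ B Y) (μ B X) (subst (_< μ B X + r) (sym balance) (+-monoʳ-< (μ B X) r'<r)))
  where
  balance : μ B Y + r ≡ μ B X + r'
  balance = subst₂ (λ u v → μ B Y + u ≡ μ B X + v)
                   (μ-singleton (proj₁ (box source)) (proj₂ (box source)))
                   (μ-singleton (<-trans r'<r (proj₁ (box source))) (proj₂ (box source)))
                   (relocation-μ B source free rel)

Reach-InBox : ∀ {B X Y} → InBox B X → Reach X Y → InBox B Y
Reach-InBox box ε = box
Reach-InBox box ((_ , mv) ◅ path) = Reach-InBox (KohnertMove-InBox box mv) path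

Reach-μ : ∀ {B X Y} → InBox B X → Reach X Y → μ B Y < μ B X ⊎ Y ≈ X
Reach-μ box ε = inj₂ ≈-refl
Reach-μ {B} box ((_ , mv) ◅ path)
  with KohnertMove-μ box mv | Reach-μ (KohnertMove-InBox box mv) path
... | inj₁ μZ<μX | inj₁ μY<μZ = inj₁ (<-trans μY<μZ μZ<μX)
... | inj₁ μZ<μX | inj₂ Y≈Z = inj₁ (subst (_< _) (μ-resp-≈ B (≈-sym Y≈Z)) μZ<μX)
... | inj₂ Z≈X | inj₁ μY<μZ = inj₁ (subst (_ <_) (μ-resp-≈ B Z≈X) μY<μZ)
... | inj₂ Z≈X | inj₂ Y≈Z = inj₂ (≈-trans Y≈Z Z≈X)

Reach-antisym : ∀ {X Y Z} → Reach X Y → Reach Y Z → Z ≈ X → Y ≈ X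
Reach-antisym {X} {Y} {Z} X→Y Y→Z Z≈X with Reach-μ (inBox-bound X) X→Y
... | inj₂ Y≈X = Y≈X
... | inj₁ μY<μX = contradiction (μ-resp-≈ B Z≈X) (<⇒≢ (≤-<-trans μZ≤μY μY<μX))
  where
  B = suc (bound X)
  μZ≤μY : μ B Z ≤ μ B Y
  μZ≤μY = [ <⇒≤ , ≤-reflexive ∘ μ-resp-≈ B ]′ (Reach-μ (Reach-InBox (inBox-bound X) X→Y) Y→Z)

movable-μ< : ∀ {B X} → InBox B X → (mv : Movable X) → μ B (moved mv) < μ B X
movable-μ< box mv =
  [ id , (λ e → contradiction e (moved-≉ mv)) ]′ (KohnertMove-μ box (moved-move mv))

normalise : ∀ X → ∃[ N ] (Reach X N × Stuck N)
normalise X = go (inBox-bound X) (<-wellFounded _)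
  where
  B = suc (bound X)
  go : ∀ {Y} → InBox B Y → Acc _<_ (μ B Y) → ∃[ N ] (Reach Y N × Stuck N)
  go {Y} box (acc rec) with stuck⊎movable Y
  ... | inj₁ stuck = Y , ε , stuck
  ... | inj₂ mv with go (KohnertMove-InBox box (moved-move mv)) (rec (movable-μ< box mv))
  ...   | N , path , stuck = N , (Movable.row mv , moved-move mv) ◅ path , stuck

-- The extremal elements of P(D)

InKD-trans : ∀ {A B C} → InKD A B → InKD B C → InKD A C
InKD-trans (F , A→F , F≈B) (G , B→G , G≈C) = G , A→F ◅◅ Reach-respˡ-≈ F≈B B→G , G≈C

minimal⇒stuck : ∀ {D m} → IsMinimal D m → Stuck m
minimal⇒stuck {D} {m} (m∈KD , minimal) with stuck⊎movable m
... | inj₁ stuck = stuck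
... | inj₂ mv = contradiction (minimal (moved mv) (InKD-trans m∈KD m→moved) m→moved) (moved-≉ mv)
  where
  m→moved : InKD m (moved mv)
  m→moved = moved mv , (Movable.row mv , moved-move mv) ◅ ε , ≈-refl

stuck⇒minimal : ∀ {D m} → InKD D m → Stuck m → IsMinimal D m
stuck⇒minimal m∈KD stuck =
  m∈KD , λ E _ (F , m→F , F≈E) → ≈-trans (≈-sym F≈E) (stuck-Reach stuck m→F)

initial-maximal : ∀ D → IsMaximal D D
initial-maximal D = (D , ε , ≈-refl) , λ E (F , D→F , F≈E) (G , E→G , G≈D) →
  ≈-trans (≈-sym F≈E) (Reach-antisym D→F (Reach-respˡ-≈ F≈E E→G) G≈D)

maximal-unique : ∀ {D M} → IsMaximal D M → M ≈ D
maximal-unique (M∈KD , maximal) = ≈-sym (maximal _ (_ , ε , ≈-refl) M∈KD)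

bounded : ∀ D → (∀ {X Y} → InKD D X → InKD D Y → Stuck X → Stuck Y → X ≈ Y) → Bounded D
bounded D stuck-unique with normalise D
... | N , D→N , stuck =
  (N , stuck⇒minimal N∈KD stuck ,
       λ _ min → stuck-unique (proj₁ min) N∈KD (minimal⇒stuck min) stuck) ,
  (D , initial-maximal D , λ _ → maximal-unique)
  where
  N∈KD : InKD D N
  N∈KD = N , D→N , ≈-refl

pred[n]<n : ∀ {n} → 1 ≤ n → pred n < n
pred[n]<n (s≤s _) = ≤-refl

record Enumeration (P : ℕ → Set) (k : ℕ) : Set where
  field
    elem : Fin k → ℕ
    elem-injective : Injective _≡_ _≡_ elem
    elem-∈ : ∀ i → P (elem i)
    elem-onto : ∀ {s} → P s → ∃[ i ] elem i ≡ s

module _ {P : ℕ → Set} {k : ℕ} (e : Enumeration P k) where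
  open Enumeration e

  Enumeration-resp : ∀ {Q : ℕ → Set} → (∀ {s} → P s → Q s) → (∀ {s} → Q s → P s) → Enumeration Q k
  Enumeration-resp P⇒Q Q⇒P = record
    { elem = elem ; elem-injective = elem-injective
    ; elem-∈ = P⇒Q ∘ elem-∈ ; elem-onto = elem-onto ∘ Q⇒P }

  Enumeration-replace : ∀ {Q : ℕ → Set} {s s'} → P s → ¬ P s' →
    (∀ {t} → Q t → (P t × t ≢ s) ⊎ t ≡ s') → (∀ {t} → (P t × t ≢ s) ⊎ t ≡ s' → Q t) →
    Enumeration Q k
  Enumeration-replace {Q} {s} {s'} Ps ¬Ps' Q⇒ ⇒Q = record
    { elem = elem' ; elem-injective = injective' ; elem-∈ = ∈' ; elem-onto = onto' }
    where
    i₀ = proj₁ (elem-onto Ps)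
    elem-i₀ : elem i₀ ≡ s
    elem-i₀ = proj₂ (elem-onto Ps)
    elem' : Fin k → ℕ
    elem' i with i Fin.≟ i₀
    ... | yes _ = s'
    ... | no _ = elem i
    elem'-i₀ : elem' i₀ ≡ s'
    elem'-i₀ with i₀ Fin.≟ i₀
    ... | yes _ = refl
    ... | no i₀≢i₀ = contradiction refl i₀≢i₀
    elem'-≢ : ∀ {i} → i ≢ i₀ → elem' i ≡ elem i
    elem'-≢ {i} i≢i₀ with i Fin.≟ i₀
    ... | yes i≡i₀ = contradiction i≡i₀ i≢i₀
    ... | no _ = refl
    elem≢s : ∀ {i} → i ≢ i₀ → elem i ≢ s
    elem≢s i≢i₀ eq = i≢i₀ (elem-injective (trans eq (sym elem-i₀)))
    injective' : Injective _≡_ _≡_ elem'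
    injective' {i} {j} eq with i Fin.≟ i₀ | j Fin.≟ i₀
    ... | yes i≡i₀ | yes j≡i₀ = trans i≡i₀ (sym j≡i₀)
    ... | yes _ | no _ = contradiction (subst P (sym eq) (elem-∈ j)) ¬Ps'
    ... | no _ | yes _ = contradiction (subst P eq (elem-∈ i)) ¬Ps'
    ... | no _ | no _ = elem-injective eq
    ∈' : ∀ i → Q (elem' i)
    ∈' i with i Fin.≟ i₀
    ... | yes _ = ⇒Q (inj₂ refl)
    ... | no i≢i₀ = ⇒Q (inj₁ (elem-∈ i , elem≢s i≢i₀))
    onto' : ∀ {t} → Q t → ∃[ i ] elem' i ≡ t
    onto' Qt with Q⇒ Qt
    ... | inj₂ refl = i₀ , elem'-i₀
    ... | inj₁ (Pt , t≢s) with elem-onto Pt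
    ...   | i , refl with i Fin.≟ i₀
    ...     | yes refl = contradiction elem-i₀ t≢s
    ...     | no i≢i₀ = i , elem'-≢ i≢i₀

  Enumeration-⊆⇒≤ : ∀ {n} → (∀ {s} → P s → 1 ≤ s × s ≤ n) → k ≤ n
  Enumeration-⊆⇒≤ {n} bounds = Fin.injective⇒≤ {f = index} index-injective
    where
    pred-elem<n : ∀ i → pred (elem i) < n
    pred-elem<n i = let (1≤s , s≤n) = bounds (elem-∈ i) in <-≤-trans (pred[n]<n 1≤s) s≤n
    index : Fin k → Fin n
    index i = fromℕ< (pred-elem<n i)
    index-injective : Injective _≡_ _≡_ index
    index-injective {i} {j} eq = elem-injective
      (pred-injective {{>-nonZero (positive i)}} {{>-nonZero (positive j)}}
        (trans (sym (Fin.toℕ-fromℕ< _)) (trans (cong toℕ eq) (Fin.toℕ-fromℕ< _))))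
      where
      positive : ∀ i → 1 ≤ elem i
      positive i = proj₁ (bounds (elem-∈ i))

  Enumeration-⊇⇒≥ : ∀ {n} → (∀ {s} → 1 ≤ s → s ≤ n → P s) → n ≤ k
  Enumeration-⊇⇒≥ {n} covers = Fin.injective⇒≤ {f = index} index-injective
    where
    index : Fin n → Fin k
    index j = proj₁ (elem-onto (covers (s≤s z≤n) (Fin.toℕ<n j)))
    index-injective : Injective _≡_ _≡_ index
    index-injective {i} {j} eq = Fin.toℕ-injective (suc-injective
      (trans (sym (proj₂ (elem-onto _))) (trans (cong elem eq) (proj₂ (elem-onto _)))))

-- Hook shapes

module HookShapes (C : List ℕ) (m k : ℕ) (≤m : ∀ {c} → c ∈ C → c ≤ m) where

  record HookShape (E : Diagram) : Set where
    field
      row-positive : ∀ {r c} → (r , c) ∈ E → 1 ≤ r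
      leg : Enumeration (λ s → (s , m) ∈ E) k
      arm-column : ∀ {r c} → c ≢ m → (r , c) ∈ E → c ∈ C
      arm-occupied : ∀ {c} → c ∈ C → c ≢ m → ∃[ r ] (r , c) ∈ E
      arm-unique : ∀ {r r' c} → c ≢ m → (r , c) ∈ E → (r' , c) ∈ E → r ≡ r'
      arm-high : ∀ {r c} → c ≢ m → (r , c) ∈ E → k ≤ r
      arm-above-leg : ∀ {r c s} → c ≢ m → (r , c) ∈ E → (s , m) ∈ E → s ≤ r

  HookShape-resp-≈ : ∀ {E E'} → E ≈ E' → HookShape E → HookShape E'
  HookShape-resp-≈ E≈E' shape = record
    { row-positive = row-positive ∘ ≈⇒⊇ E≈E'
    ; leg = Enumeration-resp leg (≈⇒⊆ E≈E') (≈⇒⊇ E≈E')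
    ; arm-column = λ c≢m → arm-column c≢m ∘ ≈⇒⊇ E≈E'
    ; arm-occupied = λ c∈C c≢m → map×₂ (≈⇒⊆ E≈E') (arm-occupied c∈C c≢m)
    ; arm-unique = λ c≢m p q → arm-unique c≢m (≈⇒⊇ E≈E' p) (≈⇒⊇ E≈E' q)
    ; arm-high = λ c≢m → arm-high c≢m ∘ ≈⇒⊇ E≈E'
    ; arm-above-leg = λ c≢m p q → arm-above-leg c≢m (≈⇒⊇ E≈E' p) (≈⇒⊇ E≈E' q)
    }
    where open HookShape shape

  leg-move-shape : ∀ {E E' r r'} → HookShape E → (r , m) ∈ E → (r' , m) ∉ E → 1 ≤ r' → r' < r →
                   Relocation E (r , m) (r' , m) E' → HookShape E'
  leg-move-shape {E} {E'} {r} {r'} shape source free 1≤r' r'<r rel = record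
    { row-positive = relocation-rows-positive row-positive 1≤r' rel
    ; leg = Enumeration-replace leg source free leg-from leg-to
    ; arm-column = λ c≢m → arm-column c≢m ∘ old c≢m
    ; arm-occupied = λ c∈C c≢m → map×₂ (kept c≢m) (arm-occupied c∈C c≢m)
    ; arm-unique = λ c≢m p q → arm-unique c≢m (old c≢m p) (old c≢m q)
    ; arm-high = λ c≢m → arm-high c≢m ∘ old c≢m
    ; arm-above-leg = arm-above-leg'
    }
    where
    open HookShape shape
    old : ∀ {ρ c} → c ≢ m → (ρ , c) ∈ E' → (ρ , c) ∈ E
    old c≢m = proj₁ (relocation-other-column rel c≢m)
    kept : ∀ {ρ c} → c ≢ m → (ρ , c) ∈ E → (ρ , c) ∈ E'
    kept c≢m = proj₂ (relocation-other-column rel c≢m)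
    leg-from : ∀ {t} → (t , m) ∈ E' → ((t , m) ∈ E × t ≢ r) ⊎ t ≡ r'
    leg-from p = map⊎ (map×₂ (λ ne → ne ∘ cong (_, m))) (cong proj₁) (proj₁ (rel _) p)
    leg-to : ∀ {t} → ((t , m) ∈ E × t ≢ r) ⊎ t ≡ r' → (t , m) ∈ E'
    leg-to = proj₂ (rel _) ∘ map⊎ (map×₂ (λ t≢r → t≢r ∘ cong proj₁)) (cong (_, m))
    arm-above-leg' : ∀ {ρ c s} → c ≢ m → (ρ , c) ∈ E' → (s , m) ∈ E' → s ≤ ρ
    arm-above-leg' c≢m p q with proj₁ (rel _) q
    ... | inj₁ (q' , _) = arm-above-leg c≢m (old c≢m p) q'
    ... | inj₂ refl = <⇒≤ (<-≤-trans r'<r (arm-above-leg c≢m (old c≢m p) source))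

  module _ {E r c r'} (shape : HookShape E) (c≢m : c ≢ m) (rightmost : Rightmost E r c)
           (r'<r : r' < r) (between : ∀ r'' → r' < r'' → r'' < r → (r'' , c) ∈ E) where
    open HookShape shape

    arm-move-drops-one : suc r' ≡ r
    arm-move-drops-one with m≤n⇒m<n∨m≡n r'<r
    ... | inj₂ eq = eq
    ... | inj₁ 1+r'<r =
      contradiction (arm-unique c≢m (between (suc r') ≤-refl 1+r'<r) (proj₁ rightmost)) (<⇒≢ 1+r'<r)

    -- An arm cell is alone in its column, so it drops by exactly one row; the leg lies weakly
    -- below row r and avoids row r itself, whose rightmost cell c is left of m.
    leg-below-arm-target : ∀ {s} → (s , m) ∈ E → s ≤ r'
    leg-below-arm-target {s} p =
      ≤-pred (subst (s <_) (sym arm-move-drops-one)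
                    (≤∧≢⇒< (arm-above-leg c≢m (proj₁ rightmost) p) s≢r))
      where
      s≢r : s ≢ r
      s≢r refl = c≢m (≤-antisym (≤m (arm-column c≢m (proj₁ rightmost))) (proj₂ rightmost m p))

    arm-target-high : k ≤ r'
    arm-target-high = Enumeration-⊆⇒≤ leg λ p → row-positive p , leg-below-arm-target p

  arm-move-shape : ∀ {E E' r c r'} → HookShape E → c ≢ m → Rightmost E r c → 1 ≤ r' → r' < r →
    (∀ r'' → r' < r'' → r'' < r → (r'' , c) ∈ E) → Relocation E (r , c) (r' , c) E' → HookShape E'
  arm-move-shape {E} {E'} {r} {c} {r'} shape c≢m rightmost 1≤r' r'<r between rel = record
    { row-positive = relocation-rows-positive row-positive 1≤r' rel
    ; leg = Enumeration-resp leg (kept (c≢m ∘ sym)) (old (c≢m ∘ sym))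
    ; arm-column = arm-column'
    ; arm-occupied = arm-occupied'
    ; arm-unique = arm-unique'
    ; arm-high = λ c₀≢m p →
        [ arm-high c₀≢m ∘ proj₁ , (λ { refl → target-high }) ]′ (proj₁ (rel _) p)
    ; arm-above-leg = λ c₀≢m p q →
        [ (λ (p' , _) → arm-above-leg c₀≢m p' (old (c≢m ∘ sym) q))
        , (λ { refl → leg-below-target q }) ]′ (proj₁ (rel _) p)
    }
    where
    open HookShape shape
    source = proj₁ rightmost
    target-high = arm-target-high shape c≢m rightmost r'<r between
    old : ∀ {ρ c₀} → c₀ ≢ c → (ρ , c₀) ∈ E' → (ρ , c₀) ∈ E
    old c₀≢c = proj₁ (relocation-other-column rel c₀≢c)
    kept : ∀ {ρ c₀} → c₀ ≢ c → (ρ , c₀) ∈ E → (ρ , c₀) ∈ E'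
    kept c₀≢c = proj₂ (relocation-other-column rel c₀≢c)
    leg-below-target : ∀ {s} → (s , m) ∈ E' → s ≤ r'
    leg-below-target = leg-below-arm-target shape c≢m rightmost r'<r between ∘ old (c≢m ∘ sym)
    arm-column' : ∀ {ρ c₀} → c₀ ≢ m → (ρ , c₀) ∈ E' → c₀ ∈ C
    arm-column' c₀≢m p with proj₁ (rel _) p
    ... | inj₁ (p' , _) = arm-column c₀≢m p'
    ... | inj₂ refl = arm-column c≢m source
    arm-occupied' : ∀ {c₀} → c₀ ∈ C → c₀ ≢ m → ∃[ ρ ] (ρ , c₀) ∈ E'
    arm-occupied' {c₀} c₀∈C c₀≢m with c₀ ≟ c
    ... | yes refl = r' , proj₂ (rel _) (inj₂ refl)
    ... | no c₀≢c = map×₂ (kept c₀≢c) (arm-occupied c₀∈C c₀≢m)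
    at-source : ∀ {ρ} → (ρ , c) ∈ E → (ρ , c) ≡ (r , c)
    at-source p = cong (_, c) (arm-unique c≢m p source)
    arm-unique' : ∀ {ρ ρ' c₀} → c₀ ≢ m → (ρ , c₀) ∈ E' → (ρ' , c₀) ∈ E' → ρ ≡ ρ'
    arm-unique' c₀≢m p q with proj₁ (rel _) p | proj₁ (rel _) q
    ... | inj₁ (p' , _) | inj₁ (q' , _) = arm-unique c₀≢m p' q'
    ... | inj₂ refl | inj₂ refl = refl
    ... | inj₁ (p' , p≢source) | inj₂ refl = contradiction (at-source p') p≢source
    ... | inj₂ refl | inj₁ (q' , q≢source) = contradiction (at-source q') q≢source

  KohnertMove-shape : ∀ {E r E'} → HookShape E → KohnertMove E r E' → HookShape E'
  KohnertMove-shape shape (empty-row _ E'≈E) = HookShape-resp-≈ (≈-sym E'≈E) shape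
  KohnertMove-shape shape (blocked _ _ _ E'≈E) = HookShape-resp-≈ (≈-sym E'≈E) shape
  KohnertMove-shape shape (move c r' rightmost 1≤r' r'<r free between rel) with c ≟ m
  ... | yes refl = leg-move-shape shape (proj₁ rightmost) free 1≤r' r'<r rel
  ... | no c≢m = arm-move-shape shape c≢m rightmost 1≤r' r'<r between rel

  Reach-shape : ∀ {E E'} → HookShape E → Reach E E' → HookShape E'
  Reach-shape shape ε = shape
  Reach-shape shape ((_ , mv) ◅ path) = Reach-shape (KohnertMove-shape shape mv) path

  InKD-shape : ∀ {E E'} → HookShape E → InKD E E' → HookShape E'
  InKD-shape shape (F , E→F , F≈E') = HookShape-resp-≈ F≈E' (Reach-shape shape E→F)

  BottomHook : ℕ → ℕ → Set
  BottomHook r c = (c ≡ m × 1 ≤ r × r ≤ k) ⊎ (c ∈ C × c ≢ m × r ≡ k)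

  module _ (1≤k : 1 ≤ k) {E} (shape : HookShape E) (stuck : Stuck E) where
    open HookShape shape

    leg-rightmost : ∀ {s} → (s , m) ∈ E → Rightmost E s m
    leg-rightmost p = p , λ c q → case c ≟ m of λ where
      (yes refl) → ≤-refl
      (no c≢m) → ≤m (arm-column c≢m q)

    leg-downward-closed : ∀ {s j} → (s , m) ∈ E → 1 ≤ j → j ≤ s → (j , m) ∈ E
    leg-downward-closed p 1≤j j≤s with m≤n⇒m<n∨m≡n j≤s
    ... | inj₁ j<s = stuck _ m (leg-rightmost p) _ 1≤j j<s
    ... | inj₂ refl = p

    leg-≤k : ∀ {s} → (s , m) ∈ E → s ≤ k
    leg-≤k p = Enumeration-⊇⇒≥ leg (leg-downward-closed p)

    leg-full : ∀ {j} → 1 ≤ j → j ≤ k → (j , m) ∈ E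
    leg-full {j} 1≤j j≤k with (j , m) ∈? E
    ... | yes p = p
    ... | no j∉E =
      contradiction (Enumeration-⊆⇒≤ leg (λ p → row-positive p , <⇒≤pred (below-j p))) (<⇒≱ pred-j<k)
      where
      below-j : ∀ {s} → (s , m) ∈ E → s < j
      below-j {s} p with j ≤? s
      ... | yes j≤s = contradiction (leg-downward-closed p 1≤j j≤s) j∉E
      ... | no j≰s = ≰⇒> j≰s
      pred-j<k : pred j < k
      pred-j<k = <-≤-trans (pred[n]<n 1≤j) j≤k

    arm-row-k : ∀ {ρ c} → c ≢ m → (ρ , c) ∈ E → ρ ≡ k
    arm-row-k {ρ} c≢m p with ρ ≤? k | RowEmpty⊎Rightmost E ρ
    ... | yes ρ≤k | _ = ≤-antisym ρ≤k (arm-high c≢m p)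
    ... | no _ | inj₁ empty = contradiction p (empty _)
    ... | no ρ≰k | inj₂ (c' , rightmost) with c' ≟ m
    ...   | yes refl = contradiction (leg-≤k (proj₁ rightmost)) ρ≰k
    ...   | no c'≢m = contradiction (arm-unique c'≢m below (proj₁ rightmost)) (<⇒≢ pred-ρ<ρ)
      where
      1<ρ : 1 < ρ
      1<ρ = ≤-<-trans 1≤k (≰⇒> ρ≰k)
      pred-ρ<ρ : pred ρ < ρ
      pred-ρ<ρ = pred[n]<n (<-trans z<s 1<ρ)
      below : (pred ρ , c') ∈ E
      below = stuck ρ c' rightmost (pred ρ) (<⇒≤pred 1<ρ) pred-ρ<ρ

    stuck-∈⇔BottomHook : ∀ {r c} → ((r , c) ∈ E → BottomHook r c) × (BottomHook r c → (r , c) ∈ E)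
    stuck-∈⇔BottomHook {r} {c} = to , from
      where
      to : (r , c) ∈ E → BottomHook r c
      to p with c ≟ m
      ... | yes refl = inj₁ (refl , row-positive p , leg-≤k p)
      ... | no c≢m = inj₂ (arm-column c≢m p , c≢m , arm-row-k c≢m p)
      from : BottomHook r c → (r , c) ∈ E
      from (inj₁ (refl , 1≤r , r≤k)) = leg-full 1≤r r≤k
      from (inj₂ (c∈C , c≢m , refl)) with arm-occupied c∈C c≢m
      ... | ρ , p = subst (λ ρ → (ρ , c) ∈ E) (arm-row-k c≢m p) p

  stuck-HookShape-unique : 1 ≤ k → ∀ {X Y} → HookShape X → Stuck X → HookShape Y → Stuck Y → X ≈ Y
  stuck-HookShape-unique 1≤k shapeX stuckX shapeY stuckY (r , c) =
    proj₂ (stuck-∈⇔BottomHook 1≤k shapeY stuckY) ∘ proj₁ (stuck-∈⇔BottomHook 1≤k shapeX stuckX) ,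
    proj₂ (stuck-∈⇔BottomHook 1≤k shapeX stuckX) ∘ proj₁ (stuck-∈⇔BottomHook 1≤k shapeY stuckY)

maxList-≤ : ∀ {C c} → c ∈ C → c ≤ maxList C
maxList-≤ {x ∷ C} (here refl) = m≤m⊔n x (maxList C)
maxList-≤ {x ∷ C} (there p) = m≤n⇒m≤o⊔n x (maxList-≤ p)

module _ {r₁ r₂ : ℕ} {C : List ℕ} (1≤r₁ : 1 ≤ r₁) (r₁≤r₂ : r₁ ≤ r₂) where
  open HookShapes C (maxList C) (suc (r₂ ∸ r₁)) maxList-≤

  ∈-H⁻ : ∀ {r c} → (r , c) ∈ H r₁ r₂ C →
         (r ≡ r₂ × c ∈ C) ⊎ (c ≡ maxList C × ∃[ j ] (j < suc (r₂ ∸ r₁) × r ≡ r₁ + j))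
  ∈-H⁻ p with ∈-++⁻ (map (r₂ ,_) C) p
  ... | inj₁ q with ∈-map⁻ (r₂ ,_) q
  ...   | c , c∈C , refl = inj₁ (refl , c∈C)
  ∈-H⁻ p | inj₂ q with ∈-map⁻ (_, maxList C) q
  ...   | _ , q' , refl with ∈-map⁻ (r₁ +_) q'
  ...     | j , j∈ , refl = inj₂ (refl , j , ∈-upTo⁻ j∈ , refl)

  leg-row : ∀ {j} → j < suc (r₂ ∸ r₁) → r₁ + j ≤ r₂
  leg-row j<k = ≤-trans (+-monoʳ-≤ r₁ (≤-pred j<k)) (≤-reflexive (m+[n∸m]≡n r₁≤r₂))

  H-rows-≤ : ∀ {r c} → (r , c) ∈ H r₁ r₂ C → r ≤ r₂
  H-rows-≤ p with ∈-H⁻ p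
  ... | inj₁ (refl , _) = ≤-refl
  ... | inj₂ (_ , j , j<k , refl) = leg-row j<k

  H-arm-row : ∀ {r c} → c ≢ maxList C → (r , c) ∈ H r₁ r₂ C → r ≡ r₂ × c ∈ C
  H-arm-row c≢m p with ∈-H⁻ p
  ... | inj₁ arm = arm
  ... | inj₂ (c≡m , _) = contradiction c≡m c≢m

  H-leg : Enumeration (λ s → (s , maxList C) ∈ H r₁ r₂ C) (suc (r₂ ∸ r₁))
  H-leg = record
    { elem = λ i → r₁ + toℕ i
    ; elem-injective = Fin.toℕ-injective ∘ +-cancelˡ-≡ r₁ _ _
    ; elem-∈ = λ i →
        ∈-++⁺ʳ (map (r₂ ,_) C) (∈-map⁺ (_, maxList C) (∈-map⁺ (r₁ +_) (∈-upTo⁺ (Fin.toℕ<n i))))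
    ; elem-onto = onto
    }
    where
    onto : ∀ {s} → (s , maxList C) ∈ H r₁ r₂ C → ∃[ i ] r₁ + toℕ i ≡ s
    onto p with ∈-H⁻ p
    ... | inj₁ (refl , _) =
      fromℕ< (n<1+n (r₂ ∸ r₁)) , trans (cong (r₁ +_) (Fin.toℕ-fromℕ< _)) (m+[n∸m]≡n r₁≤r₂)
    ... | inj₂ (_ , j , j<k , refl) = fromℕ< j<k , cong (r₁ +_) (Fin.toℕ-fromℕ< j<k)

  H-shape : HookShape (H r₁ r₂ C)
  H-shape = record
    { row-positive = λ p → ≤-trans 1≤r₁ (row≥r₁ p)
    ; leg = H-leg
    ; arm-column = λ c≢m → proj₂ ∘ H-arm-row c≢m
    ; arm-occupied = λ c∈C _ → r₂ , ∈-++⁺ˡ (∈-map⁺ (r₂ ,_) c∈C)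
    ; arm-unique = λ c≢m p q → trans (proj₁ (H-arm-row c≢m p)) (sym (proj₁ (H-arm-row c≢m q)))
    ; arm-high = λ c≢m p → subst (suc (r₂ ∸ r₁) ≤_) (sym (proj₁ (H-arm-row c≢m p))) k≤r₂
    ; arm-above-leg = λ c≢m p q → subst (_ ≤_) (sym (proj₁ (H-arm-row c≢m p))) (H-rows-≤ q)
    }
    where
    row≥r₁ : ∀ {r c} → (r , c) ∈ H r₁ r₂ C → r₁ ≤ r
    row≥r₁ p with ∈-H⁻ p
    ... | inj₁ (refl , _) = r₁≤r₂
    ... | inj₂ (_ , j , _ , refl) = m≤m+n r₁ j
    k≤r₂ : suc (r₂ ∸ r₁) ≤ r₂
    k≤r₂ = ≤-trans (+-monoˡ-≤ (r₂ ∸ r₁) 1≤r₁) (≤-reflexive (m+[n∸m]≡n r₁≤r₂))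

lemma4p5 : (D : Diagram) → IsHook D → Bounded D
lemma4p5 D (r₁ , r₂ , C , 1≤r₁ , r₁≤r₂ , _ , _ , D∈KD) = bounded D stuck-unique
  where
  open HookShapes C (maxList C) (suc (r₂ ∸ r₁)) maxList-≤
  shape : ∀ {X} → InKD D X → HookShape X
  shape X∈KD = InKD-shape (H-shape 1≤r₁ r₁≤r₂) (InKD-trans D∈KD X∈KD)
  stuck-unique : ∀ {X Y} → InKD D X → InKD D Y → Stuck X → Stuck Y → X ≈ Y
  stuck-unique X∈KD Y∈KD stuckX stuckY =
    stuck-HookShape-unique (s≤s z≤n) (shape X∈KD) stuckX (shape Y∈KD) stuckY
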